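{- Let $H$ be a finite graph and $r,s\ge1$ integers such that $i_{r,s}(H)<\left\lceil\frac{1+pw(H)}{r+s}\right\rceil$. Then every $(r,s)$-protocol that clears $H$ and has width $i_{r,s}(H)$ is not cautious.
   Context: Discrete-time immunization model. Fix integers $r,s\ge 1$ and a finite graph $H$. An $(r,s)$-protocol for $H$ is a finite sequence $(A_1,\dots,A_N)$ of subsets of $V(H)$ ($A_t$ is the set of vertices immunized at time-step $t$); its width is $\max_i|A_i|$. At time-step $0$ every vertex is red. For each $t\ge 1$ every vertex lies in exactly one of $G_t^r,\dots,G_t^1$ (green), $Y_t^s,\dots,Y_t^1$ (yellow), $R_t$ (red), determined as follows: if $v\in A_t$ then $v\in G_t^r$. If $v\notin A_t$: if $v$ was red at time $t-1$ or $v\in Y_{t-1}^1$, then $v\in R_t$; if $v\in Y_{t-1}^i$ with $2\le i\le s$, then $v\in Y_t^{i-1}$; if $v\in G_{t-1}^i$ with $2\le i\le r$, then $v\in G_t^{i-1}$; if $v\in G_{t-1}^1$ and $v$ has a neighbor in $R_t$, then $v\in Y_t^s$; otherwise $v\in G_t^1$. The protocol clears $H$ if all vertices are green at time-step $N$. $i_{r,s}(H)$ is the smallest width of an $(r,s)$-protocol that clears $H$. An $(r,s)$-protocol that clears $H$ is cautious if for every vertex $w$: if the first immunization set containing $w$ is $A_j$ and the last is $A_k$, then among any $r+s$ consecutive members of $A_j,\dots,A_k$, at least one contains $w$. $pw(H)$ denotes the pathwidth of $H$ (minimum over path decompositions $(B_1,\dots,B_m)$ of $\max_i|B_i|-1$).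 -}

module Defs where

open import Data.Nat using (ℕ; zero; suc; _+_; _∸_; _≤_; _<_; _⊔_)
open import Data.Nat.DivMod using (_/_)
open import Data.Bool using (Bool; true; false; _∧_; _∨_; not; T)
open import Data.Fin using (Fin)
open import Data.Fin.Subset using (Subset; _∈_; _∉_; ∣_∣)
open import Data.List using (List; []; _∷_; foldl; length; allFin)
open import Data.Bool.ListAction using (any)
open import Data.Bool using (if_then_else_)
open import Data.Maybe using (Maybe; just; nothing)
open import Data.Product using (Σ; ∃; _×_; _,_)
open import Data.Empty using (⊥)
open import Relation.Binary.PropositionalEquality using (_≡_)
open import Relation.Nullary using (¬_; does)
open import Data.Fin.Subset.Properties using (_∈?_)
open import Data.Fin.Properties using () renaming (_≟_ to _≟F_)
import Data.Nat as N

record Graph : Set where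
  field
    n      : ℕ
    adj    : Fin n → Fin n → Bool
    sym    : ∀ u v → adj u v ≡ adj v u
    irrefl : ∀ v → adj v v ≡ false
open Graph public

Adjacent : (H : Graph) → Fin (n H) → Fin (n H) → Set
Adjacent H u v = T (adj H u v)

-- Lists indexed by ℕ (0-based time steps / bag indices)

nth : {A : Set} → List A → ℕ → Maybe A
nth []       _       = nothing
nth (x ∷ xs) zero    = just x
nth (x ∷ xs) (suc i) = nth xs i

InAt : {m : ℕ} → List (Subset m) → ℕ → Fin m → Set
InAt L i w = Σ (Subset _) λ A → (nth L i ≡ just A) × (w ∈ A)

maxCard : {m : ℕ} → List (Subset m) → ℕ
maxCard []       = 0
maxCard (A ∷ As) = ∣ A ∣ ⊔ maxCard As

-- Colours: green i (1 ≤ i ≤ r), yellow i (1 ≤ i ≤ s), red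

data Colour : Set where
  green  : ℕ → Colour
  yellow : ℕ → Colour
  red    : Colour

isGreen : Colour → Bool
isGreen (green _) = true
isGreen _         = false

-- vertex becomes/stays red at time t when not immunized and was red or in Y^1
becomesRed : Bool → Colour → Bool
becomesRed true  _          = false
becomesRed false red        = true
becomesRed false (yellow 1) = true
becomesRed false _          = false

Protocol : Graph → Set
Protocol H = List (Subset (n H))

redNow : {m : ℕ} → (Fin m → Colour) → Subset m → Fin m → Bool
redNow prev A u = becomesRed (does (u ∈? A)) (prev u)

hasRedNbr : (H : Graph) → (Fin (n H) → Colour) → Subset (n H) → Fin (n H) → Bool
hasRedNbr H prev A v = any (λ u → adj H v u ∧ redNow prev A u) (allFin (n H))

greenDecay : (s : ℕ) → Bool → ℕ → Colour
greenDecay s redNbr (suc (suc i)) = green (suc i)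
greenDecay s true   _             = yellow s   -- G^1 with a red neighbour
greenDecay s false  i             = green i    -- G^1 without a red neighbour

nonImm : (s : ℕ) → Bool → Colour → Colour
nonImm s redNbr red                  = red
nonImm s redNbr (yellow (suc (suc i))) = yellow (suc i)
nonImm s redNbr (yellow _)           = red
nonImm s redNbr (green i)            = greenDecay s redNbr i

step : (r s : ℕ) (H : Graph) → (Fin (n H) → Colour) → Subset (n H) → Fin (n H) → Colour
step r s H prev A v =
  if does (v ∈? A) then green r else nonImm s (hasRedNbr H prev A v) (prev v)

allRed : {m : ℕ} → Fin m → Colour
allRed _ = red

finalState : (r s : ℕ) (H : Graph) → Protocol H → Fin (n H) → Colour
finalState r s H P = foldl (step r s H) allRed P

Clears : (r s : ℕ) (H : Graph) → Protocol H → Set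
Clears r s H P = ∀ v → T (isGreen (finalState r s H P v))

width : {H : Graph} → Protocol H → ℕ
width P = maxCard P

IsImmunizationNumber : (r s : ℕ) (H : Graph) → ℕ → Set
IsImmunizationNumber r s H k =
  (Σ (Protocol H) λ P → Clears r s H P × width {H} P ≡ k)
  × (∀ (P : Protocol H) → Clears r s H P → k ≤ width {H} P)

-- cautious protocol (time steps 0-based: A_1 is index 0)
Cautious : (r s : ℕ) (H : Graph) → Protocol H → Set
Cautious r s H P =
  ∀ (w : Fin (n H)) (j k : ℕ) →
    InAt P j w → (∀ i → i < j → ¬ InAt P i w) →
    InAt P k w → (∀ i → k < i → ¬ InAt P i w) →
    ∀ t → j ≤ t → t + (r + s) ≤ suc k →              -- window A_t..A_{t+r+s-1} inside A_j..A_k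
      Σ ℕ λ u → t ≤ u × u < t + (r + s) × InAt P u w

record PathDecomposition (H : Graph) : Set where
  field
    bags      : List (Subset (n H))
    coverV    : ∀ v → Σ ℕ λ i → InAt bags i v
    coverE    : ∀ u v → Adjacent H u v → Σ ℕ λ i → InAt bags i u × InAt bags i v
    interval  : ∀ v i j k → i ≤ j → j ≤ k → InAt bags i v → InAt bags k v → InAt bags j v
open PathDecomposition public

-- maximum bag size = (width of the decomposition) + 1
maxBag : {H : Graph} → PathDecomposition H → ℕ
maxBag D = maxCard (bags D)

IsPathwidthPlusOne : (H : Graph) → ℕ → Set
IsPathwidthPlusOne H p =
  (Σ (PathDecomposition H) λ D → maxBag {H} D ≡ p)
  × (∀ (D : PathDecomposition H) → p ≤ maxBag {H} D)

-- ⌈ a / b ⌉ for b ≥ 1 (0 when b = 0, never used)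
ceilDiv : ℕ → ℕ → ℕ
ceilDiv a zero    = 0
ceilDiv a (suc b) = (a + b) / suc b

-- Put L = r + s and let P be a cautious protocol of width i that clears H.  The windows
-- B_t = A_t ∪ … ∪ A_{t+L-1} form a path decomposition of H with bags of size at most L·i,
-- so pw(H) + 1 ≤ L·i, i.e. ⌈(1 + pw(H))/L⌉ ≤ i.  A vertex never immunised stays red, so
-- the windows cover V(H); cautiousness makes the windows containing a vertex consecutive.
-- For an edge xy, with y first immunised after x, either x is still being immunised when y
-- first is, or y is first immunised at most r steps after the last immunisation of x:
-- otherwise x decays to G¹ next to the red vertex y, turns yellow, and is never green again.
-- Either way x and y are immunised within L consecutive steps and share a window.
module Submission where

open import Defs
open import Data.Nat using (ℕ; _≤_; _<_; _+_)
open import Relation.Binary.PropositionalEquality using (_≡_)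
open import Relation.Nullary using (¬_)

open import Data.Nat using (zero; suc; _∸_; _*_; z≤n; s≤s; s≤s⁻¹; _≤?_; _<?_)
open import Data.Nat.Properties
open import Data.Nat.Induction using (<-rec)
open import Data.Nat.DivMod using (m<n*o⇒m/o<n)
open import Data.Bool using (true; false; T)
open import Data.Bool.Properties using (T-∧; T-≡)
open import Data.Fin using (Fin)
open import Data.Fin.Subset using (Subset; _∈_; _∉_; ∣_∣; ⊥; _∪_)
open import Data.Fin.Subset.Properties using (_∈?_; ∉⊥; x∈p∪q⁻; x∈p∪q⁺; ∣⊥∣≡0)
open import Data.Vec using ([]; _∷_)
open import Data.List using (List; []; _∷_; foldl; length; allFin; drop; applyUpTo)
open import Data.List.Membership.Propositional using (lose)
open import Data.List.Membership.Propositional.Properties using (∈-allFin)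
open import Data.List.Relation.Unary.Any.Properties using (any⁺)
open import Data.Maybe using (just)
open import Data.Product using (Σ; _×_; _,_; map₂; swap)
open import Data.Sum using (_⊎_; inj₁; inj₂; [_,_])
open import Data.Empty using (⊥-elim)
open import Function using (_∘_)
open import Function.Bundles using (Equivalence)
open import Relation.Binary.PropositionalEquality as ≡ using (refl; trans; cong; cong₂; subst)
open import Relation.Nullary using (yes; no; contradiction)
open import Relation.Nullary.Decidable using (_×-dec_)
open import Relation.Unary using (Decidable)

Least Greatest : (ℕ → Set) → ℕ → Set
Least    Q m = Q m × (∀ i → i < m → ¬ Q i)
Greatest Q m = Q m × (∀ i → m < i → ¬ Q i)

module _ {Q : ℕ → Set} (Q? : Decidable Q) where

  earliest : ∀ {a} → Q a → Σ ℕ λ m → m ≤ a × Least Q m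
  earliest {a} = <-rec (λ a → Q a → Σ ℕ λ m → m ≤ a × Least Q m) search a
    where
    search : ∀ a → (∀ {b} → b < a → Q b → Σ ℕ λ m → m ≤ b × Least Q m) →
             Q a → Σ ℕ λ m → m ≤ a × Least Q m
    search a rec qa with anyUpTo? Q? a
    ... | no none = a , ≤-refl , qa , λ i i<a qi → none (i , i<a , qi)
    ... | yes (b , b<a , qb) with rec b<a qb
    ...   | m , m≤b , least = m , ≤-trans m≤b (<⇒≤ b<a) , least

  latest : ∀ N → (∀ {i} → Q i → i < N) → ∀ {a} → Q a → Σ ℕ λ m → a ≤ m × Greatest Q m
  latest N bounded {a} = search N (m≤n+m N a)
    where
    search : ∀ g {a} → N ≤ a + g → Q a → Σ ℕ λ m → a ≤ m × Greatest Q m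
    search zero {a} N≤a qa = ⊥-elim (<⇒≱ (bounded qa) (subst (N ≤_) (+-identityʳ a) N≤a))
    search (suc g) {a} N≤a+g qa with anyUpTo? (λ i → (a <? i) ×-dec Q? i) N
    ... | no none = a , ≤-refl , qa , λ i a<i qi → none (i , bounded qi , a<i , qi)
    ... | yes (b , _ , a<b , qb) =
      let m , b≤m , greatest = search g N≤b+g qb in m , ≤-trans (<⇒≤ a<b) b≤m , greatest
      where
      N≤b+g : N ≤ b + g
      N≤b+g = ≤-trans N≤a+g (≤-trans (≤-reflexive (+-suc a g)) (+-monoˡ-≤ g a<b))

∣p∪q∣≤∣p∣+∣q∣ : ∀ {k} (p q : Subset k) → ∣ p ∪ q ∣ ≤ ∣ p ∣ + ∣ q ∣
∣p∪q∣≤∣p∣+∣q∣ []          []          = z≤n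
∣p∪q∣≤∣p∣+∣q∣ (true ∷ p)  (true ∷ q)  = s≤s (≤-trans (∣p∪q∣≤∣p∣+∣q∣ p q) (+-monoʳ-≤ ∣ p ∣ (n≤1+n _)))
∣p∪q∣≤∣p∣+∣q∣ (true ∷ p)  (false ∷ q) = s≤s (∣p∪q∣≤∣p∣+∣q∣ p q)
∣p∪q∣≤∣p∣+∣q∣ (false ∷ p) (true ∷ q)  =
  subst (∣ p ∪ q ∣ <_) (≡.sym (+-suc ∣ p ∣ ∣ q ∣)) (s≤s (∣p∪q∣≤∣p∣+∣q∣ p q))
∣p∪q∣≤∣p∣+∣q∣ (false ∷ p) (false ∷ q) = ∣p∪q∣≤∣p∣+∣q∣ p q

module _ {m : ℕ} where

  -- Out of range the member is empty, consistently with InAt.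
  _‼_ : List (Subset m) → ℕ → Subset m
  []      ‼ _     = ⊥
  (A ∷ L) ‼ zero  = A
  (A ∷ L) ‼ suc t = L ‼ t

  InAt⇒∈‼ : ∀ (L : List (Subset m)) i {w} → InAt L i w → w ∈ L ‼ i
  InAt⇒∈‼ []      i       (_ , () , _)
  InAt⇒∈‼ (A ∷ L) zero    (_ , refl , w∈A) = w∈A
  InAt⇒∈‼ (A ∷ L) (suc i) w∈               = InAt⇒∈‼ L i w∈

  ∈‼⇒InAt : ∀ (L : List (Subset m)) i {w} → w ∈ L ‼ i → InAt L i w
  ∈‼⇒InAt []      i       w∈ = ⊥-elim (∉⊥ w∈)
  ∈‼⇒InAt (A ∷ L) zero    w∈ = A , refl , w∈
  ∈‼⇒InAt (A ∷ L) (suc i) w∈ = ∈‼⇒InAt L i w∈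

  InAt? : ∀ (L : List (Subset m)) w → Decidable (λ i → InAt L i w)
  InAt? L w i with w ∈? L ‼ i
  ... | yes w∈ = yes (∈‼⇒InAt L i w∈)
  ... | no  w∉ = no (w∉ ∘ InAt⇒∈‼ L i)

  InAt⇒<length : ∀ (L : List (Subset m)) {i w} → InAt L i w → i < length L
  InAt⇒<length []      (_ , () , _)
  InAt⇒<length (A ∷ L) {zero}  _  = s≤s z≤n
  InAt⇒<length (A ∷ L) {suc i} w∈ = s≤s (InAt⇒<length L w∈)

  InAt-drop : ∀ (L : List (Subset m)) t {i w} → InAt (drop t L) i w → InAt L (t + i) w
  InAt-drop []      zero    w∈ = w∈
  InAt-drop []      (suc t) (_ , () , _)
  InAt-drop (A ∷ L) zero    w∈ = w∈
  InAt-drop (A ∷ L) (suc t) w∈ = InAt-drop L t w∈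

  ∣‼∣≤maxCard : ∀ (L : List (Subset m)) i → ∣ L ‼ i ∣ ≤ maxCard L
  ∣‼∣≤maxCard []      i       = ≤-reflexive (∣⊥∣≡0 m)
  ∣‼∣≤maxCard (A ∷ L) zero    = m≤m⊔n _ _
  ∣‼∣≤maxCard (A ∷ L) (suc i) = ≤-trans (∣‼∣≤maxCard L i) (m≤n⊔m _ _)

  FirstAt LastAt : List (Subset m) → Fin m → ℕ → Set
  FirstAt L w = Least    (λ i → InAt L i w)
  LastAt  L w = Greatest (λ i → InAt L i w)

  InWindow : List (Subset m) → ℕ → ℕ → Fin m → Set
  InWindow L t l w = Σ ℕ λ u → t ≤ u × u < t + l × InAt L u w

module _ {A : Set} where

  nth-applyUpTo : ∀ (f : ℕ → A) {n i} → i < n → nth (applyUpTo f n) i ≡ just (f i)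
  nth-applyUpTo f {suc n} {zero}  _         = refl
  nth-applyUpTo f {suc n} {suc i} (s≤s i<n) = nth-applyUpTo (f ∘ suc) i<n

  nth-applyUpTo⁻ : ∀ (f : ℕ → A) {n i x} → nth (applyUpTo f n) i ≡ just x → i < n × f i ≡ x
  nth-applyUpTo⁻ f {suc n} {zero}  refl = s≤s z≤n , refl
  nth-applyUpTo⁻ f {suc n} {suc i} eq   with nth-applyUpTo⁻ (f ∘ suc) eq
  ... | i<n , fi≡x = s≤s i<n , fi≡x

maxCard-applyUpTo : ∀ {m} (f : ℕ → Subset m) {b} → (∀ i → ∣ f i ∣ ≤ b) → ∀ n → maxCard (applyUpTo f n) ≤ b
maxCard-applyUpTo f bound zero    = z≤n
maxCard-applyUpTo f bound (suc n) = ⊔-lub (bound 0) (maxCard-applyUpTo (f ∘ suc) (bound ∘ suc) n)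

module Windows {m} (P : List (Subset m)) where

  span : ℕ → ℕ → Subset m
  span t zero    = ⊥
  span t (suc l) = P ‼ t ∪ span (suc t) l

  ∈span⁻ : ∀ t l {w} → w ∈ span t l → InWindow P t l w
  ∈span⁻ t zero    w∈ = ⊥-elim (∉⊥ w∈)
  ∈span⁻ t (suc l) w∈ with x∈p∪q⁻ (P ‼ t) (span (suc t) l) w∈
  ... | inj₁ w∈P‼t = t , ≤-refl , m<m+n t (s≤s z≤n) , ∈‼⇒InAt P t w∈P‼t
  ... | inj₂ w∈span with ∈span⁻ (suc t) l w∈span
  ...   | u , t<u , u< , w∈ = u , <⇒≤ t<u , subst (u <_) (≡.sym (+-suc t l)) u< , w∈

  ∈span⁺ : ∀ t l {w} → InWindow P t l w → w ∈ span t l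
  ∈span⁺ t zero    (u , t≤u , u<t+0 , _) = ⊥-elim (<⇒≱ (subst (u <_) (+-identityʳ t) u<t+0) t≤u)
  ∈span⁺ t (suc l) (u , t≤u , u< , w∈) with m≤n⇒m<n∨m≡n t≤u
  ... | inj₂ refl = x∈p∪q⁺ (inj₁ (InAt⇒∈‼ P t w∈))
  ... | inj₁ t<u  = x∈p∪q⁺ (inj₂ (∈span⁺ (suc t) l (u , t<u , subst (u <_) (+-suc t l) u< , w∈)))

  ∣span∣≤ : ∀ t l → ∣ span t l ∣ ≤ l * maxCard P
  ∣span∣≤ t zero    = ≤-reflexive (∣⊥∣≡0 m)
  ∣span∣≤ t (suc l) = ≤-trans (∣p∪q∣≤∣p∣+∣q∣ (P ‼ t) (span (suc t) l))
                              (+-mono-≤ (∣‼∣≤maxCard P t) (∣span∣≤ (suc t) l))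

  windows : ℕ → List (Subset m)
  windows l = applyUpTo (λ t → span t l) (length P)

  InAt-windows⁻ : ∀ l t {w} → InAt (windows l) t w → t < length P × InWindow P t l w
  InAt-windows⁻ l t (B , eq , w∈B) with nth-applyUpTo⁻ (λ t → span t l) {i = t} eq
  ... | t<N , refl = t<N , ∈span⁻ t l w∈B

  InAt-windows⁺ : ∀ l t {w} → t < length P → InWindow P t l w → InAt (windows l) t w
  InAt-windows⁺ l t t<N w∈ = span t l , nth-applyUpTo (λ t → span t l) t<N , ∈span⁺ t l w∈

  maxCard-windows : ∀ l → maxCard (windows l) ≤ l * maxCard P
  maxCard-windows l = maxCard-applyUpTo (λ t → span t l) (λ t → ∣span∣≤ t l) (length P)

Gapless : ∀ {m} → List (Subset m) → ℕ → Set
Gapless {m} P l = ∀ (v : Fin m) a b t → InAt P a v → InAt P b v → a ≤ t → t ≤ b → InWindow P t l v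

Near : ∀ {m} → List (Subset m) → ℕ → Fin m → Fin m → Set
Near P l x y = Σ ℕ λ a → InAt P a x × InWindow P a l y

module WindowDecomposition (H : Graph) (P : List (Subset (n H))) (D : ℕ)
  (covered : ∀ v → Σ ℕ λ i → InAt P i v)
  (gapless : Gapless P (suc D))
  (near    : ∀ x y → Adjacent H x y → Near P (suc D) x y ⊎ Near P (suc D) y x) where

  open Windows P

  interval′ : ∀ v i j k → i ≤ j → j ≤ k → InAt (windows (suc D)) i v → InAt (windows (suc D)) k v →
              InAt (windows (suc D)) j v
  interval′ v i j k i≤j j≤k v∈Bi v∈Bk
    with InAt-windows⁻ (suc D) i v∈Bi | InAt-windows⁻ (suc D) k v∈Bk
  ... | _ , u₁ , i≤u₁ , u₁< , v∈u₁ | k<N , u₂ , k≤u₂ , _ , v∈u₂ with j ≤? u₁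
  ...   | yes j≤u₁ = InAt-windows⁺ (suc D) j j<N (u₁ , j≤u₁ , ≤-trans u₁< (+-monoˡ-≤ (suc D) i≤j) , v∈u₁)
    where
    j<N : j < length P
    j<N = ≤-<-trans j≤k k<N
  ...   | no  j≰u₁ = InAt-windows⁺ (suc D) j (≤-<-trans j≤k k<N)
                       (gapless v u₁ u₂ j v∈u₁ v∈u₂ (<⇒≤ (≰⇒> j≰u₁)) (≤-trans j≤k k≤u₂))

  -- b lies in [a, a + D], so the window starting at b ∸ D contains both a and b.
  shareWindow : ∀ {x y} → Near P (suc D) x y →
                Σ ℕ λ t → InAt (windows (suc D)) t x × InAt (windows (suc D)) t y
  shareWindow (a , x∈a , b , a≤b , b< , y∈b) =
    t , InAt-windows⁺ (suc D) t t<N (a , t≤a , ≤-<-trans a≤b b<t+L , x∈a)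
      , InAt-windows⁺ (suc D) t t<N (b , m∸n≤m b D , b<t+L , y∈b)
    where
    t : ℕ
    t = b ∸ D
    b≤a+D : b ≤ a + D
    b≤a+D = s≤s⁻¹ (subst (b <_) (+-suc a D) b<)
    t≤a : t ≤ a
    t≤a = m≤n+o⇒m∸n≤o b D (subst (b ≤_) (+-comm a D) b≤a+D)
    b<t+L : b < t + suc D
    b<t+L = subst (b <_) (≡.sym (+-suc t D)) (s≤s (subst (b ≤_) (+-comm D t) (m≤n+m∸n b D)))
    t<N : t < length P
    t<N = ≤-<-trans t≤a (InAt⇒<length P x∈a)

  decomposition : PathDecomposition H
  decomposition = record
    { bags     = windows (suc D)
    ; coverV   = λ v → let i , v∈i = covered v in
                       i , InAt-windows⁺ (suc D) i (InAt⇒<length P v∈i)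
                             (i , ≤-refl , m<m+n i (s≤s z≤n) , v∈i)
    ; coverE   = λ x y xy → [ shareWindow , map₂ swap ∘ shareWindow ] (near x y xy)
    ; interval = interval′
    }

  maxBag-decomposition : maxBag {H} decomposition ≤ suc D * maxCard P
  maxBag-decomposition = maxCard-windows (suc D)

module Dynamics (r s : ℕ) (H : Graph) where

  State : Set
  State = Fin (n H) → Colour

  NonGreen : Colour → Set
  NonGreen c = ¬ T (isGreen c)

  step-∈ : ∀ st A {w} → w ∈ A → step r s H st A w ≡ green r
  step-∈ st A {w} w∈A with w ∈? A
  ... | yes _   = refl
  ... | no  w∉A = contradiction w∈A w∉A

  step-∉ : ∀ st A {w} → w ∉ A → step r s H st A w ≡ nonImm s (hasRedNbr H st A w) (st w)
  step-∉ st A {w} w∉A with w ∈? A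
  ... | yes w∈A = contradiction w∈A w∉A
  ... | no  _   = refl

  nonImm-nonGreen : ∀ b c → NonGreen c → NonGreen (nonImm s b c)
  nonImm-nonGreen b (green _)              ng = ⊥-elim (ng _)
  nonImm-nonGreen b (yellow zero)          _  = λ ()
  nonImm-nonGreen b (yellow (suc zero))    _  = λ ()
  nonImm-nonGreen b (yellow (suc (suc _))) _  = λ ()
  nonImm-nonGreen b red                    _  = λ ()

  nonGreen-persists : ∀ L st {w} → NonGreen (st w) → (∀ i → ¬ InAt L i w) →
                      NonGreen (foldl (step r s H) st L w)
  nonGreen-persists []      st ng _      = ng
  nonGreen-persists (A ∷ L) st {w} ng absent =
    nonGreen-persists L (step r s H st A)
      (subst NonGreen (≡.sym (step-∉ st A (λ w∈A → absent 0 (A , refl , w∈A)))) (nonImm-nonGreen _ _ ng))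
      (absent ∘ suc)

  yellowed-by-red-neighbour : ∀ st A {u v} → Adjacent H u v → u ∉ A → v ∉ A →
                              st u ≡ green 1 → st v ≡ red → step r s H st A u ≡ yellow s
  yellowed-by-red-neighbour st A {u} {v} uv u∉A v∉A u-green v-red =
    trans (step-∉ st A u∉A) (cong₂ (nonImm s) (Equivalence.to T-≡ red-neighbour) u-green)
    where
    v-redNow : T (redNow st A v)
    v-redNow with v ∈? A
    ... | yes v∈A = contradiction v∈A v∉A
    ... | no  _   = subst (T ∘ becomesRed false) (≡.sym v-red) _
    red-neighbour : T (hasRedNbr H st A u)
    red-neighbour = any⁺ _ (lose (∈-allFin v) (Equivalence.from T-∧ (uv , v-redNow)))

  -- the colouring at time-step t, i.e. after the members 0, …, t - 1 of L
  run : State → List (Subset (n H)) → ℕ → State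
  run st L       zero    = st
  run st []      (suc t) = st
  run st (A ∷ L) (suc t) = run (step r s H st A) L t

  foldl-run : ∀ L st t → foldl (step r s H) st L ≡ foldl (step r s H) (run st L t) (drop t L)
  foldl-run L       st zero    = refl
  foldl-run []      st (suc t) = refl
  foldl-run (A ∷ L) st (suc t) = foldl-run L (step r s H st A) t

  run-suc : ∀ L st {t} → t < length L → run st L (suc t) ≡ step r s H (run st L t) (L ‼ t)
  run-suc (A ∷ L) st {zero}  _         = refl
  run-suc (A ∷ L) st {suc t} (s≤s t<N) = run-suc L (step r s H st A) t<N

  red-until-immunised : ∀ L st t {v} → st v ≡ red → (∀ i → i < t → ¬ InAt L i v) → run st L t v ≡ red
  red-until-immunised L       st zero    v-red _      = v-red
  red-until-immunised []      st (suc t) v-red _      = v-red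
  red-until-immunised (A ∷ L) st (suc t) v-red absent =
    red-until-immunised L (step r s H st A) t
      (trans (step-∉ st A (λ v∈A → absent 0 (s≤s z≤n) (A , refl , v∈A))) (cong (nonImm s _) v-red))
      (λ i i<t → absent (suc i) (s≤s i<t))

  module _ (P : List (Subset (n H))) (clears : Clears r s H P) where

    green-if-not-immunised-after : ∀ t {w} → (∀ i → t ≤ i → ¬ InAt P i w) → ¬ NonGreen (run allRed P t w)
    green-if-not-immunised-after t {w} absent ng =
      nonGreen-persists (drop t P) (run allRed P t) ng (λ i → absent (t + i) (m≤m+n t i) ∘ InAt-drop P t)
        (subst (λ f → T (isGreen (f w))) (foldl-run P allRed t) (clears w))

    clears⇒immunised : ∀ v → Σ ℕ λ i → InAt P i v
    clears⇒immunised v with anyUpTo? (InAt? P v) (length P)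
    ... | yes (i , _ , v∈i) = i , v∈i
    ... | no none =
      ⊥-elim (green-if-not-immunised-after 0 (λ i _ v∈i → none (i , InAt⇒<length P v∈i , v∈i)) λ ())

    countdown : ∀ {u k} → LastAt P u k → ∀ m x → m + suc x ≡ r → m + k < length P →
                run allRed P (suc (m + k)) u ≡ green (suc x)
    countdown {u} {k} (u∈k , _) zero x refl _ =
      trans (cong (λ st → st u) (run-suc P allRed (InAt⇒<length P u∈k)))
            (step-∈ (run allRed P k) (P ‼ k) (InAt⇒∈‼ P k u∈k))
    countdown {u} {k} last@(_ , after-k) (suc m) x m+x≡r m+k<N =
      begin
        run allRed P (suc (suc m + k)) u
      ≡⟨ cong (λ st → st u) (run-suc P allRed m+k<N) ⟩
        step r s H (run allRed P (suc (m + k))) (P ‼ suc (m + k)) u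
      ≡⟨ step-∉ (run allRed P (suc (m + k))) (P ‼ suc (m + k))
                (after-k (suc (m + k)) (s≤s (m≤n+m k m)) ∘ ∈‼⇒InAt P _) ⟩
        nonImm s _ (run allRed P (suc (m + k)) u)
      ≡⟨ cong (nonImm s _)
              (countdown last m (suc x) (trans (+-suc m (suc x)) m+x≡r) (<-trans (n<1+n _) m+k<N)) ⟩
        green (suc x)
      ∎
      where open Relation.Binary.PropositionalEquality.≡-Reasoning

-- If j > k + r, then u, in G¹ at time-step k + r next to the still red v, turns yellow.
first-within-r-of-last : ∀ r′ s H P → Clears (suc r′) s H P → ∀ {u v k j} → Adjacent H u v →
                         LastAt P u k → FirstAt P v j → j ≤ suc r′ + k
first-within-r-of-last r′ s H P clears {u} {v} {k} {j} uv last@(_ , after-k) (v∈j , before-j) =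
  ≮⇒≥ λ t<j → green-if-not-immunised-after P clears (suc t) (λ i t<i → after-k i (<-trans k<t t<i))
    (subst NonGreen (≡.sym (turns-yellow t<j)) λ ())
  where
  open Dynamics (suc r′) s H
  t : ℕ
  t = suc (r′ + k)
  k<t : k < t
  k<t = s≤s (m≤n+m k r′)
  turns-yellow : t < j → run allRed P (suc t) u ≡ yellow s
  turns-yellow t<j =
    trans (cong (λ st → st u) (run-suc P allRed t<N))
      (yellowed-by-red-neighbour _ _ uv
        (after-k t k<t ∘ ∈‼⇒InAt P t)
        (before-j t t<j ∘ ∈‼⇒InAt P t)
        (countdown P clears last r′ 0 (+-comm r′ 1) (<-trans (n<1+n _) t<N))
        (red-until-immunised P allRed t refl (λ i i<t → before-j i (<-trans i<t t<j))))
    where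
    t<N : t < length P
    t<N = <-trans t<j (InAt⇒<length P v∈j)

cautious⇒gapless : ∀ r s H P → Cautious r s H P → Gapless P (r + s)
cautious⇒gapless r s H P cautious v a b t v∈a v∈b a≤t t≤b with b <? t + (r + s)
... | yes b<t+L = b , t≤b , b<t+L , v∈b
... | no  b≮t+L with earliest (InAt? P v) v∈a | latest (InAt? P v) (length P) (InAt⇒<length P) v∈b
...   | j , j≤a , v∈j , before-j | k , b≤k , v∈k , after-k =
  cautious v j k v∈j before-j v∈k after-k t (≤-trans j≤a a≤t) (≤-trans (≮⇒≥ b≮t+L) (m≤n⇒m≤1+n b≤k))

adjacent-sym : ∀ H {x y} → Adjacent H x y → Adjacent H y x
adjacent-sym H {x} {y} = subst T (Graph.sym H x y)

module CautiousClearing (r′ s′ : ℕ) (H : Graph) (P : Protocol H)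
  (clears : Clears (suc r′) (suc s′) H P) (cautious : Cautious (suc r′) (suc s′) H P) where

  L : ℕ
  L = suc r′ + suc s′

  first-immunisation : ∀ v → Σ ℕ (FirstAt P v)
  first-immunisation v =
    let _ , v∈i = Dynamics.clears⇒immunised (suc r′) (suc s′) H P clears v
        j , _ , first = earliest (InAt? P v) v∈i
    in j , first

  near-ordered : ∀ {x y jx jy} → Adjacent H x y → FirstAt P x jx → FirstAt P y jy → jx ≤ jy →
                 Near P L x y ⊎ Near P L y x
  near-ordered {x} {y} {jx} {jy} xy (x∈jx , _) first-y@(y∈jy , _) jx≤jy
    with latest (InAt? P x) (length P) (InAt⇒<length P) x∈jx
  ... | kx , jx≤kx , last-x@(x∈kx , _) with jy ≤? kx
  ...   | yes jy≤kx =
          inj₂ (jy , y∈jy , cautious⇒gapless (suc r′) (suc s′) H P cautious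
                                x jx kx jy x∈jx x∈kx jx≤jy jy≤kx)
  ...   | no  jy≰kx = inj₁ (kx , x∈kx , jy , <⇒≤ (≰⇒> jy≰kx) , ≤-<-trans jy≤r+kx r+kx<kx+L , y∈jy)
    where
    jy≤r+kx : jy ≤ suc r′ + kx
    jy≤r+kx = first-within-r-of-last r′ (suc s′) H P clears xy last-x first-y
    r+kx<kx+L : suc r′ + kx < kx + L
    r+kx<kx+L = subst (_< kx + L) (+-comm kx (suc r′)) (+-monoʳ-< kx (m<m+n (suc r′) (s≤s z≤n)))

  adjacent⇒near : ∀ x y → Adjacent H x y → Near P L x y ⊎ Near P L y x
  adjacent⇒near x y xy with first-immunisation x | first-immunisation y
  ... | jx , first-x | jy , first-y with ≤-total jx jy
  ...   | inj₁ jx≤jy = near-ordered xy first-x first-y jx≤jy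
  ...   | inj₂ jy≤jx = [ inj₂ , inj₁ ] (near-ordered (adjacent-sym H xy) first-y first-x jy≤jx)

ceilDiv-≤ : ∀ D {p i} → p ≤ suc D * i → ceilDiv p (suc D) ≤ i
ceilDiv-≤ D {p} {i} p≤ = s≤s⁻¹ (m<n*o⇒m/o<n (s≤s p+D≤D+i*L))
  where
  open ≤-Reasoning
  p+D≤D+i*L : p + D ≤ D + i * suc D
  p+D≤D+i*L = begin
    p + D           ≤⟨ +-monoˡ-≤ D p≤ ⟩
    suc D * i + D   ≡⟨ cong (_+ D) (*-comm (suc D) i) ⟩
    i * suc D + D   ≡⟨ +-comm (i * suc D) D ⟩
    D + i * suc D   ∎

corollary3p12 : (H : Graph) (r s : ℕ) → 1 ≤ r → 1 ≤ s →
    (i p : ℕ) → IsImmunizationNumber r s H i → IsPathwidthPlusOne H p →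
    i < ceilDiv p (r + s) →
    ∀ (P : Protocol H) → Clears r s H P → width {H} P ≡ i → ¬ Cautious r s H P
corollary3p12 H (suc r′) (suc s′) (s≤s z≤n) (s≤s z≤n) _ p _ (_ , pw-minimal) i<⌈p/L⌉ P clears refl cautious =
  <⇒≱ i<⌈p/L⌉ (ceilDiv-≤ (r′ + suc s′) (≤-trans (pw-minimal decomposition) maxBag-decomposition))
  where
  open CautiousClearing r′ s′ H P clears cautious
  open WindowDecomposition H P (r′ + suc s′)
         (Dynamics.clears⇒immunised (suc r′) (suc s′) H P clears)
         (cautious⇒gapless (suc r′) (suc s′) H P cautious)
         adjacent⇒near
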